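{- Let $M$ be a coarse groupoid and let $U$ be a $^*$subgroup of $M$ such that $RC(U)$ (equivalently $LC(U)$) is finite. Then there is a normal $^*$subgroup $N$ of $M$ with $N\sqsubseteq U$.
   Context: A groupoid is a small category in which every morphism has an inverse; objects are identified with their identity morphisms. A coarse groupoid $M$ is a groupoid whose objects are called $^*$subgroups and whose morphisms are called $^*$cosets, together with a partial order $\sqsubseteq$ on the morphisms, to which a least element $0$ (not a morphism) is adjoined, such that any two $^*$subgroups $U,V$ have an infimum $U\wedge V$ among the $^*$subgroups. For a morphism $A:U\to V$ we say $A$ is a right $^*$coset of $U$ and a left $^*$coset of $V$; $RC(U)$ and $LC(V)$ denote the sets of right $^*$cosets of $U$ and left $^*$cosets of $V$. The product $AB$ is the composite, defined when the codomain of $A$ equals the domain of $B$; $A^{ -1}$ is the inverse. $A\perp B$ means that $A$ and $B$ have no common lower bound other than $0$. The following axioms hold: (A1) if $A\sqsubseteq B$ then $A^{ -1}\sqsubseteq B^{ -1}$; (A2) if $U\sqsubseteq V$ then for every $B\in RC(V)$ there is $A\in RC(U)$ with $A\sqsubseteq B$, and for every $A\in RC(U)$ there is $B\in RC(V)$ with $A\sqsubseteq B$; (A3) if $AB$ and $A'B'$ are defined and $A\sqsubseteq A'$, $B\sqsubseteq B'$, then $AB\sqsubseteq A'B'$; (A4) if $A\in RC(U)$, $B\in RC(V)$ and $U\sqsubseteq V$ then $A\sqsubseteq B$ or $A\perp B$; (A5) if $A\not\sqsubseteq B$ then there is a $^*$coset $C\sqsubseteq A$ with $C\perp B$. A $^*$subgroup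 $N$ is normal if $LC(N)=RC(N)$. -}

module Defs where

open import Level using (Level; _⊔_; suc)
open import Data.Product using (Σ; Σ-syntax; ∃; ∃-syntax; _×_; _,_; proj₁)
open import Data.Sum using (_⊎_)
open import Data.Nat using (ℕ)
open import Data.Fin using (Fin)
open import Data.Empty using (⊥)
open import Relation.Nullary using (¬_)
open import Relation.Binary.PropositionalEquality using (_≡_)
open import Relation.Binary.Structures using (IsPartialOrder)
open import Function.Bundles using (_↔_; _⇔_)

-- Objects (= *subgroups) form the type Ob, morphisms
-- (= *cosets) U → V form Hom U V.  Objects are
-- identified with their identity morphisms (see `obj`).  The partial order
-- ⊑ is on cosets; the adjoined least element 0 is not represented: "A ⊥ B"
-- (no common lower bound other than 0) means no coset lies below both.
-- Composition is written diagrammatically: A · B is defined when the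
-- codomain of A equals the domain of B (the paper's AB).
record CoarseGroupoid (o h r : Level) : Set (suc (o ⊔ h ⊔ r)) where
  infixl 7 _·_
  infix 4 _⊑_
  field
    Ob    : Set o
    Hom   : Ob → Ob → Set h
    idm   : (U : Ob) → Hom U U
    _·_   : ∀ {U V W} → Hom U V → Hom V W → Hom U W
    inv   : ∀ {U V} → Hom U V → Hom V U
    ·-assoc  : ∀ {U V W X} (A : Hom U V) (B : Hom V W) (C : Hom W X) →
               (A · B) · C ≡ A · (B · C)
    ·-idˡ    : ∀ {U V} (A : Hom U V) → idm U · A ≡ A
    ·-idʳ    : ∀ {U V} (A : Hom U V) → A · idm V ≡ A
    inv-·ʳ   : ∀ {U V} (A : Hom U V) → A · inv A ≡ idm U
    inv-·ˡ   : ∀ {U V} (A : Hom U V) → inv A · A ≡ idm V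

  Coset : Set (o ⊔ h)
  Coset = Σ[ U ∈ Ob ] Σ[ V ∈ Ob ] Hom U V

  dom : Coset → Ob
  dom (U , _ , _) = U

  cod : Coset → Ob
  cod (_ , V , _) = V

  obj : Ob → Coset
  obj U = (U , U , idm U)

  field
    _⊑_          : Coset → Coset → Set r
    ⊑-isPartialOrder : IsPartialOrder _≡_ _⊑_

  _⊥⊥_ : Coset → Coset → Set (o ⊔ h ⊔ r)
  A ⊥⊥ B = ¬ (Σ[ C ∈ Coset ] (C ⊑ A × C ⊑ B))

  _⊑ₒ_ : Ob → Ob → Set r
  U ⊑ₒ V = obj U ⊑ obj V

  RC : Ob → Set (o ⊔ h)
  RC U = Σ[ V ∈ Ob ] Hom U V

  LC : Ob → Set (o ⊔ h)
  LC V = Σ[ U ∈ Ob ] Hom U V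

  field
    _∧_      : Ob → Ob → Ob
    ∧-lowerˡ : ∀ U V → (U ∧ V) ⊑ₒ U
    ∧-lowerʳ : ∀ U V → (U ∧ V) ⊑ₒ V
    ∧-greatest : ∀ U V W → W ⊑ₒ U → W ⊑ₒ V → W ⊑ₒ (U ∧ V)
    A1 : ∀ {U V U' V'} (A : Hom U V) (B : Hom U' V') →
         (U , V , A) ⊑ (U' , V' , B) → (V , U , inv A) ⊑ (V' , U' , inv B)
    A2-down : ∀ {U V} → U ⊑ₒ V → (B : RC V) →
              Σ[ A ∈ RC U ] ((U , A) ⊑ (V , B))
    A2-up   : ∀ {U V} → U ⊑ₒ V → (A : RC U) →
              Σ[ B ∈ RC V ] ((U , A) ⊑ (V , B))
    A3 : ∀ {U V W U' V' W'} (A : Hom U V) (B : Hom V W)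
           (A' : Hom U' V') (B' : Hom V' W') →
         (U , V , A) ⊑ (U' , V' , A') → (V , W , B) ⊑ (V' , W' , B') →
         (U , W , A · B) ⊑ (U' , W' , A' · B')
    A4 : ∀ {U V} (A : RC U) (B : RC V) → U ⊑ₒ V →
         ((U , A) ⊑ (V , B)) ⊎ ((U , A) ⊥⊥ (V , B))
    A5 : ∀ (A B : Coset) → ¬ (A ⊑ B) →
         Σ[ C ∈ Coset ] (C ⊑ A × C ⊥⊥ B)

  -- N is normal iff LC(N) = RC(N) as sets of *cosets
  IsNormal : Ob → Set (o ⊔ h)
  IsNormal N = ∀ (A : Coset) → (cod A ≡ N) ⇔ (dom A ≡ N)

Finite : ∀ {a} → Set a → Set a
Finite A = Σ[ n ∈ ℕ ] (Fin n ↔ A)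

-- Take N to be the meet of U and the codomains of the finitely many right
-- *cosets of U (the core of U).  Given B : X → N, lift B⁻¹ by (A2) to a
-- *coset F_A over the codomain of each A ∈ RC(U); then A ↦ A·F_A maps RC(U)
-- to itself.  It is injective: if A·F = A'·F' then F'F⁻¹ lies above the
-- identity of N, hence equals the identity of V' by (A4), and A = A'.  By
-- finiteness it is surjective, and (A1)-(A3) give X ⊑ cod(A·F_A), so X ⊑ N.
-- Applying this to the inverse of an extension of B and using (A4) once more
-- yields X = N, i.e. every *coset into N starts at N.
module Submission where

open import Data.Product using (Σ-syntax; _×_; _,_; proj₁; proj₂; ∃)
open import Data.Product.Properties using (Σ-≡,≡←≡)
open import Data.Sum using (inj₁; inj₂)
open import Data.Nat using (zero; suc)
open import Data.Nat.Properties using (<-irrefl)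
open import Data.Fin using (Fin; zero; suc; punchOut)
open import Data.Fin.Properties using (_≟_; any?; punchOut-injective; injective⇒≤)
open import Data.Empty using (⊥-elim)
open import Relation.Nullary using (yes; no)
open import Relation.Binary.PropositionalEquality
open import Relation.Binary.Structures using (IsPartialOrder)
open import Function using (_∘_)
open import Function.Bundles using (Inverse; Injection; mk⇔)
open import Function.Definitions using (Injective)
open import Function.Properties.Inverse using (↔⇒↣; ↔-sym)

open import Defs

Fin-injective⇒surjective : ∀ {n} {f : Fin n → Fin n} → Injective _≡_ _≡_ f →
                           ∀ j → ∃ λ i → f i ≡ j
Fin-injective⇒surjective {zero}      _     ()
Fin-injective⇒surjective {suc n} {f} f-inj j with any? (λ i → f i ≟ j)
... | yes hit  = hit
... | no  miss = ⊥-elim (<-irrefl refl (injective⇒≤ {f = squeeze} squeeze-injective))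
  where
  avoids : ∀ i → j ≢ f i
  avoids i j≡fi = miss (i , sym j≡fi)

  squeeze : Fin (suc n) → Fin n
  squeeze i = punchOut (avoids i)

  squeeze-injective : Injective _≡_ _≡_ squeeze
  squeeze-injective {x} {y} eq = f-inj (punchOut-injective (avoids x) (avoids y) eq)

Finite-injective⇒surjective : ∀ {a} {A : Set a} → Finite A → {f : A → A} →
                              Injective _≡_ _≡_ f → ∀ y → ∃ λ x → f x ≡ y
Finite-injective⇒surjective (_ , Fin↔A) {f} f-inj y =
  let i , hit = Fin-injective⇒surjective {f = from ∘ f ∘ to}
                  (to-injective ∘ f-inj ∘ from-injective) (from y)
  in to i , from-injective hit
  where
  open Inverse Fin↔A using (to; from)
  to-injective : Injective _≡_ _≡_ to
  to-injective = Injection.injective (↔⇒↣ Fin↔A)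
  from-injective : Injective _≡_ _≡_ from
  from-injective = Injection.injective (↔⇒↣ (↔-sym Fin↔A))

module _ {o h r} (M : CoarseGroupoid o h r) where
  open CoarseGroupoid M
  open IsPartialOrder ⊑-isPartialOrder using (antisym)
    renaming (refl to ⊑-refl; trans to ⊑-trans)

  cod-mono : ∀ {C D} → C ⊑ D → cod C ⊑ₒ cod D
  cod-mono {_ , Q , C} {_ , Y , D} C⊑D =
    subst₂ (λ c d → (Q , Q , c) ⊑ (Y , Y , d)) (inv-·ˡ C) (inv-·ˡ D)
      (A3 (inv C) C (inv D) D (A1 C D C⊑D) C⊑D)

  overlap⇒⊑ : ∀ {C D E} → dom D ⊑ₒ dom C → E ⊑ C → E ⊑ D → D ⊑ C
  overlap⇒⊑ {_ , Q , C} {_ , Y , D} {E} dom⊑ E⊑C E⊑D with A4 (Y , D) (Q , C) dom⊑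
  ... | inj₁ D⊑C  = D⊑C
  ... | inj₂ D⊥⊥C = ⊥-elim (D⊥⊥C (E , E⊑D , E⊑C))

  overlap⇒≡ : ∀ {V} {C D : RC V} {E} → E ⊑ (V , C) → E ⊑ (V , D) →
              _≡_ {A = Coset} (V , C) (V , D)
  overlap⇒≡ E⊑C E⊑D =
    antisym (overlap⇒⊑ ⊑-refl E⊑D E⊑C) (overlap⇒⊑ ⊑-refl E⊑C E⊑D)

  obj⊑·inv : ∀ {N X V V' Z} {E : Hom N X} {F : Hom V Z} {F' : Hom V' Z} →
             (N , X , E) ⊑ (V , Z , F) → (N , X , E) ⊑ (V' , Z , F') →
             obj N ⊑ (V' , V , F' · inv F)
  obj⊑·inv {E = E} {F} {F'} E⊑F E⊑F' =
    subst (λ e → (_ , _ , e) ⊑ (_ , _ , F' · inv F)) (inv-·ʳ E)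
      (A3 E (inv E) F' (inv F) E⊑F' (A1 E F E⊑F))

  ·-transposeʳ : ∀ {U V V' Z} {A : Hom U V} {A' : Hom U V'}
                 (F : Hom V Z) (F' : Hom V' Z) →
                 A · F ≡ A' · F' → A ≡ A' · (F' · inv F)
  ·-transposeʳ {A = A} {A'} F F' AF≡A'F' = begin
    A                  ≡⟨ sym (·-idʳ A) ⟩
    A · idm _          ≡⟨ cong (A ·_) (sym (inv-·ʳ F)) ⟩
    A · (F · inv F)    ≡⟨ sym (·-assoc A F (inv F)) ⟩
    (A · F) · inv F    ≡⟨ cong (_· inv F) AF≡A'F' ⟩
    (A' · F') · inv F  ≡⟨ ·-assoc A' F' (inv F) ⟩
    A' · (F' · inv F)  ∎
    where open ≡-Reasoning

  ·-idʳ-coset : ∀ {U V W} (A : Hom U V) (K : Hom V W) → (V , W , K) ≡ obj V →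
                _≡_ {A = RC U} (W , A · K) (V , A)
  ·-idʳ-coset A K refl = cong (_ ,_) (·-idʳ A)

  ⋀ : ∀ {k} → Ob → (Fin k → Ob) → Ob
  ⋀ {zero}  W f = W
  ⋀ {suc k} W f = f zero ∧ ⋀ W (f ∘ suc)

  ⋀-lowerᵇ : ∀ {k} W (f : Fin k → Ob) → ⋀ W f ⊑ₒ W
  ⋀-lowerᵇ {zero}  W f = ⊑-refl
  ⋀-lowerᵇ {suc k} W f = ⊑-trans (∧-lowerʳ _ _) (⋀-lowerᵇ W (f ∘ suc))

  ⋀-lower : ∀ {k} W (f : Fin k → Ob) i → ⋀ W f ⊑ₒ f i
  ⋀-lower W f zero    = ∧-lowerˡ _ _
  ⋀-lower W f (suc i) = ⊑-trans (∧-lowerʳ _ _) (⋀-lower W (f ∘ suc) i)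

  ⋀-greatest : ∀ {k} W (f : Fin k → Ob) Y →
               Y ⊑ₒ W → (∀ i → Y ⊑ₒ f i) → Y ⊑ₒ ⋀ W f
  ⋀-greatest {zero}  W f Y Y⊑W Y⊑f = Y⊑W
  ⋀-greatest {suc k} W f Y Y⊑W Y⊑f =
    ∧-greatest _ _ Y (Y⊑f zero) (⋀-greatest W (f ∘ suc) Y Y⊑W (Y⊑f ∘ suc))

  module _ (U : Ob) (fin : Finite (RC U)) where
    open Inverse (proj₂ fin) using (to; from; strictlyInverseˡ)

    codomain : Fin (proj₁ fin) → Ob
    codomain = proj₁ ∘ to

    core : Ob
    core = ⋀ U codomain

    core⊑ : core ⊑ₒ U
    core⊑ = ⋀-lowerᵇ U codomain

    core⊑cod : (p : RC U) → core ⊑ₒ proj₁ p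
    core⊑cod p =
      subst (λ q → core ⊑ₒ proj₁ q) (strictlyInverseˡ p) (⋀-lower U codomain (from p))

    core-greatest : ∀ Y → (∀ (p : RC U) → Y ⊑ₒ proj₁ p) → Y ⊑ₒ core
    core-greatest Y Y⊑cod = ⋀-greatest U codomain Y (Y⊑cod (U , idm U)) (Y⊑cod ∘ to)

    module _ {X} (B : Hom X core) where
      lift : (p : RC U) → Σ[ q ∈ RC (proj₁ p) ] ((core , X , inv B) ⊑ (proj₁ p , q))
      lift p = A2-up (core⊑cod p) (X , inv B)

      translate : RC U → RC U
      translate p = let (Z , F) , _ = lift p in Z , proj₂ p · F

      translate-injective : Injective _≡_ _≡_ translate
      translate-injective {V , A} {V' , A'} eq
        with lift (V , A) | lift (V' , A') | Σ-≡,≡←≡ eq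
      ... | (_ , F) , E⊑F | (_ , F') , E⊑F' | refl , AF≡A'F' = begin
        (V , A)                  ≡⟨ cong (V ,_) (·-transposeʳ F F' AF≡A'F') ⟩
        (V , A' · (F' · inv F))  ≡⟨ ·-idʳ-coset A' (F' · inv F) F'F⁻¹≡id ⟩
        (V' , A')                ∎
        where
        open ≡-Reasoning
        F'F⁻¹≡id : (V' , V , F' · inv F) ≡ obj V'
        F'F⁻¹≡id = overlap⇒≡ (obj⊑·inv E⊑F E⊑F') (core⊑cod (V' , A'))

      dom⊑core : X ⊑ₒ core
      dom⊑core = core-greatest X X⊑cod
        where
        X⊑cod : ∀ p → X ⊑ₒ proj₁ p
        X⊑cod p with Finite-injective⇒surjective fin translate-injective p
        ... | p₀ , refl = cod-mono (proj₂ (lift p₀))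

    into-core⇒≡ : ∀ {X} → Hom X core → X ≡ core
    into-core⇒≡ {X} B with A2-up (dom⊑core B) (core , B)
    ... | (Q , G) , B⊑G = cong cod (antisym B⁻¹⊑G⁻¹ G⁻¹⊑B⁻¹)
      where
      B⁻¹⊑G⁻¹ : (core , X , inv B) ⊑ (Q , core , inv G)
      B⁻¹⊑G⁻¹ = A1 B G B⊑G
      G⁻¹⊑B⁻¹ : (Q , core , inv G) ⊑ (core , X , inv B)
      G⁻¹⊑B⁻¹ = overlap⇒⊑ (dom⊑core (inv G)) ⊑-refl B⁻¹⊑G⁻¹

    core-normal : IsNormal core
    core-normal (_ , _ , C) =
      mk⇔ (λ { refl → into-core⇒≡ C }) (λ { refl → into-core⇒≡ (inv C) })

mainTheorem6 : ∀ {o h r} (M : CoarseGroupoid o h r) (U : CoarseGroupoid.Ob M) →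
               Finite (CoarseGroupoid.RC M U) →
               Σ[ N ∈ CoarseGroupoid.Ob M ]
                 (CoarseGroupoid.IsNormal M N × CoarseGroupoid._⊑ₒ_ M N U)
mainTheorem6 M U fin = core M U fin , core-normal M U fin , core⊑ M U fin
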